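{- Let $(W,\preccurlyeq)$ be a partially ordered set and let $S\colon W\to W$ be an arbitrary function. The following are equivalent: (1) $S$ is forward confluent, i.e. for all $w,v\in W$, if $w\preccurlyeq v$ then $S(w)\preccurlyeq S(v)$; (2) for every monotone valuation $V$ on $W$ and every formula $\varphi$ of the language $\mathcal L$, the set $[\![\varphi]\!]=\{w\in W\mid (W,\preccurlyeq,S,V),w\models\varphi\}$ is upwards closed under $\preccurlyeq$ (i.e. $w\in[\![\varphi]\!]$ and $w\preccurlyeq v$ imply $v\in[\![\varphi]\!]$).
   Context: Formulas of $\mathcal L$ are given by $\varphi::= p\mid\bot\mid\varphi\wedge\varphi\mid\varphi\vee\varphi\mid\varphi\to\varphi\mid\bigcirc\varphi\mid\Diamond\varphi\mid\Box\varphi$ with $p$ ranging over a countable set $\mathbb P$ of propositional variables. A monotone valuation on $(W,\preccurlyeq)$ is a map $V\colon W\to 2^{\mathbb P}$ with $w\preccurlyeq v\Rightarrow V(w)\subseteq V(v)$. Write $S^0(w)=w$, $S^{k+1}(w)=S(S^k(w))$. For $\mathcal M=(W,\preccurlyeq,S,V)$ satisfaction is: $\mathcal M,w\models p$ iff $p\in V(w)$; $\bot$ is never satisfied; $\wedge,\vee$ as usual; $\mathcal M,w\models\varphi\to\psi$ iff for all $v\succcurlyeq w$, $\mathcal M,v\models\varphi$ implies $\mathcal M,v\models\psi$; $\mathcal M,w\models\bigcirc\varphi$ iff $\mathcal M,S(w)\models\varphi$; $\mathcal M,w\models\Diamond\varphi$ iff there is $k\ge 0$ with $\mathcal M,S^k(w)\models\varphi$;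 $\mathcal M,w\models\Box\varphi$ iff for all $k\ge0$, $\mathcal M,S^k(w)\models\varphi$. -}

module Defs where

open import Level using (Level; _⊔_)
open import Data.Nat using (ℕ)
open import Data.Empty.Polymorphic using (⊥)
open import Data.Product using (_×_; ∃-syntax)
open import Data.Sum using (_⊎_)
open import Relation.Binary.Bundles using (Poset)

-- Formulas of L; propositional variables are indexed by ℕ (countable set P).
data Form : Set where
  var   : ℕ → Form
  ⊥'    : Form
  _∧'_  : Form → Form → Form
  _∨'_  : Form → Form → Form
  _⇒'_  : Form → Form → Form
  ○'    : Form → Form
  ◇'    : Form → Form
  □'    : Form → Form

iter : ∀ {a} {A : Set a} → (A → A) → ℕ → A → A
iter f ℕ.zero x    = x
iter f (ℕ.suc k) x = f (iter f k x)

module _ {c ℓ₁ ℓ₂} (P : Poset c ℓ₁ ℓ₂) where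
  open Poset P renaming (Carrier to W; _≤_ to _≼_)

  ForwardConfluent : (W → W) → Set (c ⊔ ℓ₂)
  ForwardConfluent S = ∀ {w v} → w ≼ v → S w ≼ S v

  -- a valuation: V w p  means  p ∈ V(w)
  Valuation : Set (Level.suc ℓ₂ ⊔ c)
  Valuation = W → ℕ → Set ℓ₂

  Monotone : Valuation → Set (c ⊔ ℓ₂)
  Monotone V = ∀ {w v} → w ≼ v → ∀ p → V w p → V v p

  Sat : (W → W) → Valuation → W → Form → Set (c ⊔ ℓ₂)
  Sat S V w (var p)   = Level.Lift c (V w p)
  Sat S V w ⊥'        = ⊥
  Sat S V w (φ ∧' ψ)  = Sat S V w φ × Sat S V w ψ
  Sat S V w (φ ∨' ψ)  = Sat S V w φ ⊎ Sat S V w ψ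
  Sat S V w (φ ⇒' ψ)  = ∀ v → w ≼ v → Sat S V v φ → Sat S V v ψ
  Sat S V w (○' φ)    = Sat S V (S w) φ
  Sat S V w (◇' φ)    = ∃[ k ] Sat S V (iter S k w) φ
  Sat S V w (□' φ)    = ∀ k → Sat S V (iter S k w) φ

  UpClosed : (W → W) → Valuation → Form → Set (c ⊔ ℓ₂)
  UpClosed S V φ = ∀ {w v} → Sat S V w φ → w ≼ v → Sat S V v φ

-- (⇒) Monotonicity of S propagates to every iterate S^k, which is exactly
--     what the clauses for ○, ◇ and □ require; the remaining clauses are the
--     usual intuitionistic ones (→ is persistent by transitivity of ≼), so
--     persistence follows by induction on φ.
-- (⇐) Given w ≼ v, take the valuation making a variable true precisely on the
--     principal up-set ↑S(w).  It is monotone and w ⊨ ○p, so persistence of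
--     ○p gives v ⊨ ○p, i.e. S(w) ≼ S(v).
module Submission where

open import Defs
open import Relation.Binary.Bundles using (Poset)
open import Function.Bundles using (_⇔_; mk⇔)
open import Data.Nat using (zero; suc)
open import Data.Product using (_,_)
open import Data.Sum using (inj₁; inj₂)
open import Level using (lift; lower)

iter-preserves : ∀ {a r} {A : Set a} (_R_ : A → A → Set r) (f : A → A) →
  (∀ {x y} → x R y → f x R f y) →
  ∀ k {x y} → x R y → iter f k x R iter f k y
iter-preserves _R_ f f-pres zero    xRy = xRy
iter-preserves _R_ f f-pres (suc k) xRy = f-pres (iter-preserves _R_ f f-pres k xRy)

module _ {c ℓ₁ ℓ₂} (P : Poset c ℓ₁ ℓ₂) (S : Poset.Carrier P → Poset.Carrier P) where
  open Poset P renaming (Carrier to W; _≤_ to _≼_)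

  persistence : ForwardConfluent P S →
    ∀ (V : Valuation P) → Monotone P V → ∀ φ → UpClosed P S V φ
  persistence fc V V-mono = up
    where
    S^k-mono : ∀ k {w v} → w ≼ v → iter S k w ≼ iter S k v
    S^k-mono = iter-preserves _≼_ S fc

    up : ∀ φ → UpClosed P S V φ
    up (var p)  w⊨p        w≼v = lift (V-mono w≼v p (lower w⊨p))
    up ⊥'       ()         w≼v
    up (φ ∧' ψ) (w⊨φ , w⊨ψ) w≼v = up φ w⊨φ w≼v , up ψ w⊨ψ w≼v
    up (φ ∨' ψ) (inj₁ w⊨φ) w≼v = inj₁ (up φ w⊨φ w≼v)
    up (φ ∨' ψ) (inj₂ w⊨ψ) w≼v = inj₂ (up ψ w⊨ψ w≼v)
    up (φ ⇒' ψ) w⊨φ⇒ψ      w≼v = λ u v≼u → w⊨φ⇒ψ u (trans w≼v v≼u)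
    up (○' φ)   Sw⊨φ       w≼v = up φ Sw⊨φ (fc w≼v)
    up (◇' φ)   (k , w⊨φ)  w≼v = k , up φ w⊨φ (S^k-mono k w≼v)
    up (□' φ)   w⊨□φ       w≼v = λ k → up φ (w⊨□φ k) (S^k-mono k w≼v)

  principal : W → Valuation P
  principal x y _ = x ≼ y

  principal-monotone : ∀ x → Monotone P (principal x)
  principal-monotone x y≼z _ x≼y = trans x≼y y≼z

  confluence : (∀ (V : Valuation P) → Monotone P V → ∀ φ → UpClosed P S V φ) →
    ForwardConfluent P S
  confluence persistent {w} {v} w≼v =
    lower (persistent (principal (S w)) (principal-monotone (S w))
                      (○' (var 0)) (lift refl) w≼v)

proposition1 : ∀ {c ℓ₁ ℓ₂} (P : Poset c ℓ₁ ℓ₂) (S : Poset.Carrier P → Poset.Carrier P) →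
    ForwardConfluent P S ⇔ (∀ (V : Valuation P) → Monotone P V → ∀ φ → UpClosed P S V φ)
proposition1 P S = mk⇔ (persistence P S) (confluence P S)
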